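{- For the problem of minimizing makespan for online job scheduling on $m \ge 2$ identical machines, $\textsc{Greedy}$ has online bounded ratio exactly $2-\frac{1}{m-1}$.
   Context: Jobs with positive sizes arrive online and each must be assigned irrevocably (without preemption) to one of $m$ identical machines; the load of a machine is the total size of jobs assigned to it, and the makespan is the maximum load; the goal is to minimize the makespan. $\textsc{Greedy}$ assigns each job to a currently least loaded machine (ties arbitrary). For a deterministic online algorithm $A$ of a minimization problem, $\textsc{Opt}_A$ denotes an offline algorithm that is optimal among offline algorithms whose solution on any input $I$ satisfies, for every prefix $I'$ of $I$, that the cost of the solution restricted to $I'$ is at most $A(I')$. The online bounded ratio of $A$ is the infimum of all constants $c$ such that $A(I) \le c\,\textsc{Opt}_A(I)$ for all inputs $I$.
   Formalization: Job sizes are positive rationals, and the constants c in the infimum defining the online bounded ratio are taken over the rationals. -}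

module Defs where

open import Data.Nat using (ℕ; suc; zero)
open import Data.Integer using (+_)
open import Data.Rational using (ℚ; 0ℚ; _+_; _*_; _-_; _/_; _≤_; _<_; _⊔_)
open import Data.Fin using (Fin; _≟_)
open import Data.List using (List; []; _∷_; take; length; map; foldr; allFin)
open import Data.List.Relation.Unary.All using (All)
open import Data.Product using (Σ; ∃; _×_)
open import Relation.Binary.PropositionalEquality using (_≡_)
open import Relation.Nullary using (yes; no)

PositiveJobs : List ℚ → Set
PositiveJobs js = All (λ p → 0ℚ < p) js

-- A schedule on m machines assigns the i-th job to the i-th machine in the list.
Schedule : ℕ → Set
Schedule m = List (Fin m)

load : ∀ {m} → List ℚ → Schedule m → Fin m → ℚ
load (p ∷ js) (j ∷ s) i with i ≟ j
... | yes _ = p + load js s i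
... | no  _ = load js s i
load _ _ i = 0ℚ

-- Makespan: maximum load over all machines (loads are nonnegative).
makespan : ∀ {m} → List ℚ → Schedule m → ℚ
makespan {m} js s = foldr _⊔_ 0ℚ (map (load js s) (allFin m))

IsSchedule : ∀ {m} → List ℚ → Schedule m → Set
IsSchedule js s = length s ≡ length js

addLoad : ∀ {m} → (Fin m → ℚ) → Fin m → ℚ → (Fin m → ℚ)
addLoad L j p i with i ≟ j
... | yes _ = L i + p
... | no  _ = L i

-- GreedyFrom L js s: starting from loads L, s is a run of Greedy on js,
-- each job going to some currently least loaded machine (ties arbitrary).
data GreedyFrom {m : ℕ} (L : Fin m → ℚ) : List ℚ → Schedule m → Set where
  []  : GreedyFrom L [] []
  _∷_ : ∀ {p js j s} → (∀ i → L j ≤ L i) →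
        GreedyFrom (addLoad L j p) js s → GreedyFrom L (p ∷ js) (j ∷ s)

IsGreedy : ∀ {m} → List ℚ → Schedule m → Set
IsGreedy js s = GreedyFrom (λ _ → 0ℚ) js s

-- Feasible for Opt_A, where the online algorithm A produced schedule a on js
-- (so A's solution on the prefix of length k is the prefix of a):
-- t schedules js and on every prefix its cost is at most A's cost.
FeasibleFor : ∀ {m} → List ℚ → Schedule m → Schedule m → Set
FeasibleFor js a t =
  IsSchedule js t ×
  (∀ (k : ℕ) → makespan (take k js) (take k t) ≤ makespan (take k js) (take k a))

IsOptA : ∀ {m} → List ℚ → Schedule m → ℚ → Set
IsOptA {m} js a v =
  (Σ (Schedule m) λ t → FeasibleFor js a t × makespan js t ≡ v) ×
  (∀ (t : Schedule m) → FeasibleFor js a t → v ≤ makespan js t)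

GreedyBoundedBy : ℕ → ℚ → Set
GreedyBoundedBy m c =
  ∀ (js : List ℚ) → PositiveJobs js →
  ∀ (s : Schedule m) → IsGreedy js s →
  ∀ (v : ℚ) → IsOptA js s v → makespan js s ≤ c * v

IsInfimum : (ℚ → Set) → ℚ → Set
IsInfimum P r = (∀ c → P c → r ≤ c) × (∀ d → (∀ c → P c → d ≤ c) → d ≤ r)

GreedyOnlineBoundedRatio : ℕ → ℚ → Set
GreedyOnlineBoundedRatio m r = IsInfimum (GreedyBoundedBy m) r

module Submission where

-- Both halves compare Greedy with an offline schedule that is
-- never worse than Greedy on any prefix.
--
-- Upper bound.  Track Greedy's loads A and the competitor's loads B job by job.
-- Invariant: both are nonnegative, have the same total, and every Greedy load
-- satisfies M·A(i) ≤ (M+k)·max B.  When Greedy puts p on a least loaded machine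
-- (load g), the new load g + p obeys the bound: the machine holding Greedy's
-- makespan G ≥ max B and M machines of load ≥ g give G + M·g ≤ total, while the
-- total is ≤ o + M·max B for the competitor's chosen machine (load o); cancelling
-- and using o + p ≤ max B' gives M·(g+p) ≤ (M+k)·max B'.  Since M·r = M + k, the
-- invariant yields Greedy ≤ r·Opt.
--
-- Lower bound.  Jobs: 1, then k rounds of M jobs of size u = 1/M, then 1.
-- Greedy spreads the small jobs over machines 1..M and ends with load k·u + 1 = r,
-- whereas the schedule putting them on the k machines 2..M has makespan 1 and is
-- feasible for Opt_Greedy, so every valid ratio c satisfies r ≤ c.

open import Defs
open import Data.Nat as ℕ using (ℕ; suc; zero)
open import Data.Integer using (+_)
import Data.Integer.Properties as ℤ
open import Data.Rational
open import Data.Rational.Properties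
import Data.Rational.Unnormalised as ℚᵘ
import Data.Rational.Unnormalised.Properties as ℚᵘ
open import Data.Rational.Solver using (module +-*-Solver)
open import Data.Fin as Fin using (Fin; zero; suc; punchIn)
import Data.Fin.Properties as Fin
import Data.Nat.Properties as ℕ
open import Data.List as List using (List; []; _∷_; _++_; take; length; map; foldr; allFin; replicate; tabulate; concat)
import Data.List.Properties as List
open import Data.List.Membership.Propositional using (_∈_)
open import Data.List.Membership.Propositional.Properties using (∈-allFin)
open import Data.List.Relation.Unary.Any using (here; there)
open import Data.List.Relation.Unary.All using ([]; _∷_)
open import Data.List.Relation.Unary.All.Properties using (take⁺; ++⁺; replicate⁺)
open import Data.Vec.Functional using (removeAt)
open import Data.Sum using (_⊎_; inj₁; inj₂)
open import Data.Product using (∃; _,_; proj₁)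
open import Function.Base using (_∘_)
open import Function.Definitions using (Injective)
open import Relation.Nullary using (yes; no; contradiction)
open import Relation.Binary.PropositionalEquality
open import Algebra.Bundles using (CommutativeRing)
open import Algebra.Properties.CommutativeMonoid.Sum +-0-commutativeMonoid
  using (sum; sum-remove; sum-replicate; sum-replicate-zero; sum-cong-≗)
open import Algebra.Properties.CommutativeMonoid.Mult +-0-commutativeMonoid
  using (_×_; ×-homo-+; ×-distrib-+)
open import Algebra.Properties.Semiring.Mult (CommutativeRing.semiring +-*-commutativeRing)
  using (×-assoc-*)

open +-*-Solver

private
  variable
    m n : ℕ

-- The largest entry of a load vector (0 for no machines); makespan js s is
-- definitionally maxLoad (load js s).
maxLoad : (Fin m → ℚ) → ℚ
maxLoad {m} L = foldr _⊔_ 0ℚ (map L (allFin m))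

module _ (L : Fin m → ℚ) where

  maxOver-nonneg : ∀ is → 0ℚ ≤ foldr _⊔_ 0ℚ (map L is)
  maxOver-nonneg [] = ≤-refl
  maxOver-nonneg (i ∷ is) = ≤-trans (maxOver-nonneg is) (p≤q⊔p (L i) _)

  maxOver-ub : ∀ {i is} → i ∈ is → L i ≤ foldr _⊔_ 0ℚ (map L is)
  maxOver-ub (here refl) = p≤p⊔q _ _
  maxOver-ub {is = j ∷ _} (there i∈is) = ≤-trans (maxOver-ub i∈is) (p≤q⊔p (L j) _)

  maxOver-lub : ∀ {c} is → (∀ i → L i ≤ c) → 0ℚ ≤ c → foldr _⊔_ 0ℚ (map L is) ≤ c
  maxOver-lub [] _ 0≤c = 0≤c
  maxOver-lub (i ∷ is) L≤c 0≤c = ⊔-lub (L≤c i) (maxOver-lub is L≤c 0≤c)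

  maxOver-attained : ∀ is → foldr _⊔_ 0ℚ (map L is) ≡ 0ℚ ⊎ ∃ λ i → foldr _⊔_ 0ℚ (map L is) ≡ L i
  maxOver-attained [] = inj₁ refl
  maxOver-attained (i ∷ is) with ⊔-sel (L i) (foldr _⊔_ 0ℚ (map L is)) | maxOver-attained is
  ... | inj₁ max≡Li | _              = inj₂ (i , max≡Li)
  ... | inj₂ max≡rest | inj₁ rest≡0  = inj₁ (trans max≡rest rest≡0)
  ... | inj₂ max≡rest | inj₂ (j , e) = inj₂ (j , trans max≡rest e)

  maxLoad-nonneg : 0ℚ ≤ maxLoad L
  maxLoad-nonneg = maxOver-nonneg (allFin m)

  maxLoad-ub : ∀ i → L i ≤ maxLoad L
  maxLoad-ub i = maxOver-ub (∈-allFin i)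

  maxLoad-lub : ∀ {c} → (∀ i → L i ≤ c) → 0ℚ ≤ c → maxLoad L ≤ c
  maxLoad-lub = maxOver-lub (allFin m)

maxLoad-attained : (L : Fin (suc n) → ℚ) → (∀ i → 0ℚ ≤ L i) → ∃ λ i → maxLoad L ≤ L i
maxLoad-attained {n} L L≥0 with maxOver-attained L (allFin (suc n))
... | inj₁ max≡0       = zero , subst (_≤ L zero) (sym max≡0) (L≥0 zero)
... | inj₂ (i , max≡Li) = i , ≤-reflexive max≡Li

maxLoad-cong : {L L′ : Fin m → ℚ} → (∀ i → L i ≡ L′ i) → maxLoad L ≡ maxLoad L′
maxLoad-cong {m} L≗L′ = cong (foldr _⊔_ 0ℚ) (List.map-cong L≗L′ (allFin m))

maxLoad-mono : {L L′ : Fin m → ℚ} → (∀ i → L i ≤ L′ i) → maxLoad L ≤ maxLoad L′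
maxLoad-mono {L′ = L′} L≤L′ = maxLoad-lub _ (λ i → ≤-trans (L≤L′ i) (maxLoad-ub L′ i)) (maxLoad-nonneg L′)

-- Integer multiples n × a = a + ⋯ + a over ℚ: monotonicity, and cancellation of a
-- positive multiplier, used to pass between M·x ≤ (M+k)·y and x ≤ r·y.

×-monoʳ-≤ : ∀ n {a b} → a ≤ b → n × a ≤ n × b
×-monoʳ-≤ zero    _   = ≤-refl
×-monoʳ-≤ (suc n) a≤b = +-mono-≤ a≤b (×-monoʳ-≤ n a≤b)

×-monoʳ-< : ∀ n {a b} → a < b → suc n × a < suc n × b
×-monoʳ-< n a<b = +-mono-<-≤ a<b (×-monoʳ-≤ n (<⇒≤ a<b))

×-zeroʳ : ∀ n → n × 0ℚ ≡ 0ℚ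
×-zeroʳ n = trans (sym (sum-replicate n)) (sum-replicate-zero n)

×-nonneg : ∀ n {a} → 0ℚ ≤ a → 0ℚ ≤ n × a
×-nonneg n {a} 0≤a = subst (_≤ n × a) (×-zeroʳ n) (×-monoʳ-≤ n 0≤a)

×-cancelʳ-≤ : ∀ n {a b} → suc n × a ≤ suc n × b → a ≤ b
×-cancelʳ-≤ n {a} {b} na≤nb with a ≤? b
... | yes a≤b = a≤b
... | no  a≰b = contradiction (<-≤-trans (×-monoʳ-< n (≰⇒> a≰b)) na≤nb) (<-irrefl refl)

+-cancelˡ-≤ : ∀ a {x y} → a + x ≤ a + y → x ≤ y
+-cancelˡ-≤ a {x} {y} a+x≤a+y = subst₂ _≤_ (undo x) (undo y) (+-monoʳ-≤ (- a) a+x≤a+y)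
  where
  undo : ∀ z → - a + (a + z) ≡ z
  undo z = solve 2 (λ a z → (:- a) :+ (a :+ z) := z) refl a z

p≤p+q : ∀ p {q} → 0ℚ ≤ q → p ≤ p + q
p≤p+q p {q} 0≤q = subst (_≤ p + q) (+-identityʳ p) (+-monoʳ-≤ p 0≤q)

sum-mono-≤ : {f g : Fin n → ℚ} → (∀ i → f i ≤ g i) → sum f ≤ sum g
sum-mono-≤ {zero}  _   = ≤-refl
sum-mono-≤ {suc n} f≤g = +-mono-≤ (f≤g zero) (sum-mono-≤ (λ i → f≤g (suc i)))

sum-lower : (f : Fin (suc n) → ℚ) {a : ℚ} → (∀ i → a ≤ f i) → ∀ i → f i + n × a ≤ sum f
sum-lower {n} f {a} a≤f i = begin
  f i + n × a                       ≡⟨ cong (_+_ (f i)) (sum-replicate n) ⟨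
  f i + sum (λ (_ : Fin n) → a)     ≤⟨ +-monoʳ-≤ (f i) (sum-mono-≤ (λ k → a≤f (punchIn i k))) ⟩
  f i + sum (removeAt f i)          ≡⟨ sum-remove f ⟨
  sum f                             ∎
  where open ≤-Reasoning

sum-upper : (f : Fin (suc n) → ℚ) {b : ℚ} → (∀ i → f i ≤ b) → ∀ i → sum f ≤ f i + n × b
sum-upper {n} f {b} f≤b i = begin
  sum f                             ≡⟨ sum-remove f ⟩
  f i + sum (removeAt f i)          ≤⟨ +-monoʳ-≤ (f i) (sum-mono-≤ (λ k → f≤b (punchIn i k))) ⟩
  f i + sum (λ (_ : Fin n) → b)     ≡⟨ cong (_+_ (f i)) (sum-replicate n) ⟩
  f i + n × b                       ∎
  where open ≤-Reasoning

addLoad-same : (A : Fin m → ℚ) (j : Fin m) (p : ℚ) → addLoad A j p j ≡ A j + p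
addLoad-same A j p with j Fin.≟ j
... | yes _   = refl
... | no  j≢j = contradiction refl j≢j

addLoad-other : (A : Fin m → ℚ) (j : Fin m) (p : ℚ) {i : Fin m} → i ≢ j → addLoad A j p i ≡ A i
addLoad-other A j p {i} i≢j with i Fin.≟ j
... | yes i≡j = contradiction i≡j i≢j
... | no  _   = refl

addLoad-elim : (P : Fin m → ℚ → Set) (A : Fin m → ℚ) (j : Fin m) (p : ℚ) →
               P j (A j + p) → (∀ i → P i (A i)) → ∀ i → P i (addLoad A j p i)
addLoad-elim P A j p Pj P-old i with i Fin.≟ j
... | yes refl = Pj
... | no  _    = P-old i

addLoad-grows : (A : Fin m → ℚ) (j : Fin m) {p : ℚ} → 0ℚ ≤ p → ∀ i → A i ≤ addLoad A j p i
addLoad-grows A j {p} 0≤p = addLoad-elim (λ i v → A i ≤ v) A j p (p≤p+q (A j) 0≤p) (λ _ → ≤-refl)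

sum-addLoad : (A : Fin (suc n) → ℚ) (j : Fin (suc n)) (p : ℚ) → sum (addLoad A j p) ≡ sum A + p
sum-addLoad A j p = begin
  sum (addLoad A j p)                          ≡⟨ sum-remove {i = j} (addLoad A j p) ⟩
  addLoad A j p j + sum (removeAt (addLoad A j p) j)
    ≡⟨ cong₂ _+_ (addLoad-same A j p) (sum-cong-≗ (λ k → addLoad-other A j p (Fin.punchInᵢ≢i j k))) ⟩
  (A j + p) + sum (removeAt A j)              ≡⟨ solve 3 (λ a p s → (a :+ p) :+ s := (a :+ s) :+ p) refl (A j) p _ ⟩
  (A j + sum (removeAt A j)) + p              ≡⟨ cong (_+ p) (sum-remove {i = j} A) ⟨
  sum A + p                                    ∎
  where open ≡-Reasoning

loadsAfter : (Fin m → ℚ) → List ℚ → Schedule m → Fin m → ℚ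
loadsAfter A (p ∷ js) (j ∷ s) = loadsAfter (addLoad A j p) js s
loadsAfter A _        _       = A

idle : Fin m → ℚ
idle _ = 0ℚ

loadsAfter-load : (A : Fin m → ℚ) (js : List ℚ) (s : Schedule m) (i : Fin m) →
                  loadsAfter A js s i ≡ A i + load js s i
loadsAfter-load A []       _       i = sym (+-identityʳ (A i))
loadsAfter-load A (p ∷ js) []      i = sym (+-identityʳ (A i))
loadsAfter-load A (p ∷ js) (j ∷ s) i = trans (loadsAfter-load (addLoad A j p) js s i) shift
  where
  shift : addLoad A j p i + load js s i ≡ A i + load (p ∷ js) (j ∷ s) i
  shift with i Fin.≟ j
  ... | yes _ = +-assoc (A i) p (load js s i)
  ... | no  _ = refl

makespan-loads : (js : List ℚ) (s : Schedule m) → makespan js s ≡ maxLoad (loadsAfter idle js s)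
makespan-loads js s = maxLoad-cong (λ i → trans (sym (+-identityˡ _)) (sym (loadsAfter-load idle js s i)))

makespan-≤ : (js : List ℚ) (s : Schedule m) {c : ℚ} →
             (∀ i → loadsAfter idle js s i ≤ c) → 0ℚ ≤ c → makespan js s ≤ c
makespan-≤ js s loads≤c 0≤c = subst (_≤ _) (sym (makespan-loads js s)) (maxLoad-lub _ loads≤c 0≤c)

loadsAfter-++ : (A : Fin m → ℚ) (xs : List ℚ) (as : Schedule m) {ys : List ℚ} {bs : Schedule m} →
                length xs ≡ length as → loadsAfter A (xs ++ ys) (as ++ bs) ≡ loadsAfter (loadsAfter A xs as) ys bs
loadsAfter-++ A []       []       _   = refl
loadsAfter-++ A (p ∷ xs) (j ∷ as) len = loadsAfter-++ (addLoad A j p) xs as (ℕ.suc-injective len)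

loadsAfter-grows : (A : Fin m → ℚ) {js : List ℚ} → PositiveJobs js → ∀ s i → A i ≤ loadsAfter A js s i
loadsAfter-grows A []           _       i = ≤-refl
loadsAfter-grows A (_ ∷ _)      []      i = ≤-refl
loadsAfter-grows A (p>0 ∷ js>0) (j ∷ s) i =
  ≤-trans (addLoad-grows A j (<⇒≤ p>0) i) (loadsAfter-grows (addLoad A j _) js>0 s i)

loadsAfter-prefix : (A : Fin m → ℚ) {js : List ℚ} → PositiveJobs js → ∀ n s i →
                    loadsAfter A (take n js) (take n s) i ≤ loadsAfter A js s i
loadsAfter-prefix A js>0       zero    s       i = loadsAfter-grows A js>0 s i
loadsAfter-prefix A []         (suc n) s       i = ≤-refl
loadsAfter-prefix A (_ ∷ _)    (suc n) []      i = ≤-refl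
loadsAfter-prefix A (_ ∷ js>0) (suc n) (j ∷ s) i = loadsAfter-prefix (addLoad A j _) js>0 n s i

makespan-≥-first : ∀ {p js} (j : Fin m) (s : Schedule m) → PositiveJobs js → p ≤ makespan (p ∷ js) (j ∷ s)
makespan-≥-first {p = p} {js} j s js>0 = begin
  p                                         ≡⟨ +-identityˡ p ⟨
  0ℚ + p                                    ≡⟨ addLoad-same idle j p ⟨
  addLoad idle j p j                        ≤⟨ loadsAfter-grows (addLoad idle j p) js>0 s j ⟩
  loadsAfter idle (p ∷ js) (j ∷ s) j        ≤⟨ maxLoad-ub _ j ⟩
  maxLoad (loadsAfter idle (p ∷ js) (j ∷ s)) ≡⟨ makespan-loads (p ∷ js) (j ∷ s) ⟨
  makespan (p ∷ js) (j ∷ s)                 ∎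
  where open ≤-Reasoning

-- The competitive ratio 2 - 1/(k+1) for k + 2 machines.
ratio : ℕ → ℚ
ratio k = + 2 / 1 - + 1 / suc k

unit-fraction-sum : ∀ k → suc k × (+ 1 / suc k) ≡ 1ℚ
unit-fraction-sum k = toℚᵘ-injective (ℚᵘ.≃-trans (copies (suc k)) (ℚᵘ.*≡* (ℤ.*-comm (+ suc k) (+ 1))))
  where
  copies : ∀ n → toℚᵘ (n × (+ 1 / suc k)) ℚᵘ.≃ ℚᵘ.mkℚᵘ (+ n) k
  copies zero    = ℚᵘ.*≡* refl
  copies (suc n) = ℚᵘ.≃-trans (toℚᵘ-homo-+ (+ 1 / suc k) (n × (+ 1 / suc k)))
    (ℚᵘ.≃-trans (ℚᵘ.+-cong (toℚᵘ-fromℚᵘ (ℚᵘ.mkℚᵘ (+ 1) k)) (copies n))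
                (ℚᵘ.*≡* (same-denominator (+ 1) (+ n) (+ suc k))))
    where
    open import Data.Integer using () renaming (_+_ to _+ℤ_; _*_ to _*ℤ_)
    same-denominator : ∀ a b d → (a *ℤ d +ℤ b *ℤ d) *ℤ d ≡ (a +ℤ b) *ℤ (d *ℤ d)
    same-denominator a b d = trans (cong (_*ℤ d) (sym (ℤ.*-distribʳ-+ d a b))) (ℤ.*-assoc (a +ℤ b) d d)

×-as-* : ∀ n y → n × y ≡ (n × 1ℚ) * y
×-as-* n y = trans (cong (n ×_) (sym (*-identityˡ y))) (sym (×-assoc-* n 1ℚ y))

scaled-ratio : ∀ k x → suc k × (ratio k * x) ≡ (suc k ℕ.+ k) × x
scaled-ratio k x = begin
  suc k × (ratio k * x)           ≡⟨ ×-as-* (suc k) _ ⟩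
  M̂ * ((1ℚ + 1ℚ + - u) * x)
    ≡⟨ solve 3 (λ M u x → M :* ((con 1ℚ :+ con 1ℚ :+ :- u) :* x) := (M :+ M :+ :- (M :* u)) :* x) refl M̂ u x ⟩
  (M̂ + M̂ + - (M̂ * u)) * x        ≡⟨ cong (λ y → (M̂ + M̂ + - y) * x) M̂u≡1 ⟩
  (M̂ + M̂ + - 1ℚ) * x
    ≡⟨ solve 2 (λ N x → ((con 1ℚ :+ N) :+ (con 1ℚ :+ N) :+ :- con 1ℚ) :* x := ((con 1ℚ :+ N) :+ N) :* x)
               refl (k × 1ℚ) x ⟩
  (M̂ + k × 1ℚ) * x                ≡⟨ cong (_* x) (×-homo-+ 1ℚ (suc k) k) ⟨
  ((suc k ℕ.+ k) × 1ℚ) * x        ≡⟨ ×-as-* (suc k ℕ.+ k) x ⟨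
  (suc k ℕ.+ k) × x               ∎
  where
  open ≡-Reasoning
  M̂ u : ℚ
  M̂ = suc k × 1ℚ
  u = + 1 / suc k
  M̂u≡1 : M̂ * u ≡ 1ℚ
  M̂u≡1 = trans (sym (×-as-* (suc k) u)) (unit-fraction-sum k)

module UpperBound (k : ℕ) where

  M : ℕ
  M = suc k

  Loads : Set
  Loads = Fin (suc M) → ℚ

  record Dominated (A B : Loads) : Set where
    field
      greedy-nonneg : ∀ i → 0ℚ ≤ A i
      other-nonneg  : ∀ i → 0ℚ ≤ B i
      same-total    : sum A ≡ sum B
      scaled-bound  : ∀ i → M × A i ≤ (M ℕ.+ k) × maxLoad B

  open Dominated

  least-loaded-bound : ∀ {A B} → Dominated A B → ∀ {j} (j′ : Fin (suc M)) {p} →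
    (∀ i → A j ≤ A i) → 0ℚ ≤ p → maxLoad B ≤ maxLoad A →
    M × (A j + p) ≤ (M ℕ.+ k) × maxLoad (addLoad B j′ p)
  least-loaded-bound {A} {B} inv {j} j′ {p} least 0≤p B≤A = begin
    M × (g + p)                       ≡⟨ ×-distrib-+ g p M ⟩
    M × g + (p + k × p)               ≤⟨ +-monoˡ-≤ (p + k × p) Mg≤ ⟩
    (o + k × O′) + (p + k × p)
      ≡⟨ solve 4 (λ o x p y → (o :+ x) :+ (p :+ y) := (o :+ p) :+ (x :+ y)) refl o (k × O′) p (k × p) ⟩
    (o + p) + (k × O′ + k × p)        ≤⟨ +-mono-≤ o+p≤O′ (+-monoʳ-≤ (k × O′) (×-monoʳ-≤ k p≤O′)) ⟩
    O′ + (k × O′ + k × O′)            ≡⟨ cong (_+_ O′) (×-homo-+ O′ k k) ⟨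
    (M ℕ.+ k) × O′                    ∎
    where
    open ≤-Reasoning
    g o O O′ : ℚ
    g  = A j
    o  = B j′
    O  = maxLoad B
    O′ = maxLoad (addLoad B j′ p)

    -- Greedy's makespan sits on some machine i₀, and every other machine has load ≥ g.
    O+Mg≤total : O + M × g ≤ sum A
    O+Mg≤total with maxLoad-attained A (greedy-nonneg inv)
    ... | i₀ , max≤Ai₀ = ≤-trans (+-monoˡ-≤ (M × g) (≤-trans B≤A max≤Ai₀)) (sum-lower A least i₀)

    total≤o+MO : sum A ≤ o + M × O
    total≤o+MO = subst (_≤ o + M × O) (sym (same-total inv)) (sum-upper B (maxLoad-ub B) j′)

    Mg≤ : M × g ≤ o + k × O′
    Mg≤ = ≤-trans (+-cancelˡ-≤ O (begin
      O + M × g                       ≤⟨ ≤-trans O+Mg≤total total≤o+MO ⟩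
      o + (O + k × O)                 ≡⟨ solve 3 (λ o O x → o :+ (O :+ x) := O :+ (o :+ x)) refl o O (k × O) ⟩
      O + (o + k × O)                 ∎))
      (+-monoʳ-≤ o (×-monoʳ-≤ k (maxLoad-mono (addLoad-grows B j′ 0≤p))))

    o+p≤O′ : o + p ≤ O′
    o+p≤O′ = subst (_≤ O′) (addLoad-same B j′ p) (maxLoad-ub (addLoad B j′ p) j′)

    p≤O′ : p ≤ O′
    p≤O′ = ≤-trans (subst (_≤ o + p) (+-identityˡ p) (+-monoˡ-≤ p (other-nonneg inv j′))) o+p≤O′

  dominated-step : ∀ {A B} → Dominated A B → ∀ {j} (j′ : Fin (suc M)) {p} →
    (∀ i → A j ≤ A i) → 0ℚ ≤ p → maxLoad B ≤ maxLoad A →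
    Dominated (addLoad A j p) (addLoad B j′ p)
  dominated-step {A} {B} inv {j} j′ {p} least 0≤p B≤A = record
    { greedy-nonneg = λ i → ≤-trans (greedy-nonneg inv i) (addLoad-grows A j 0≤p i)
    ; other-nonneg  = λ i → ≤-trans (other-nonneg inv i) (addLoad-grows B j′ 0≤p i)
    ; same-total    = trans (sum-addLoad A j p) (trans (cong (_+ p) (same-total inv)) (sym (sum-addLoad B j′ p)))
    ; scaled-bound  = addLoad-elim (λ _ v → M × v ≤ (M ℕ.+ k) × maxLoad (addLoad B j′ p)) A j p
        (least-loaded-bound inv j′ least 0≤p B≤A)
        (λ i → ≤-trans (scaled-bound inv i) (×-monoʳ-≤ (M ℕ.+ k) (maxLoad-mono (addLoad-grows B j′ 0≤p))))
    }

  greedy-dominated : ∀ {A B js s} (t : Schedule (suc M)) → Dominated A B → GreedyFrom A js s →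
    PositiveJobs js → length t ≡ length js →
    (∀ n → maxLoad (loadsAfter B (take n js) (take n t)) ≤ maxLoad (loadsAfter A (take n js) (take n s))) →
    Dominated (loadsAfter A js s) (loadsAfter B js t)
  greedy-dominated t        inv []              _            _   _     = inv
  greedy-dominated []       inv (_ ∷ _)         _            ()  _
  greedy-dominated (j′ ∷ t) inv (least ∷ greedy) (p>0 ∷ js>0) len ahead =
    greedy-dominated t (dominated-step inv j′ least (<⇒≤ p>0) (ahead 0)) greedy js>0 (ℕ.suc-injective len)
      (λ n → ahead (suc n))

  upper-bound : GreedyBoundedBy (suc M) (ratio k)
  upper-bound js js>0 s greedy _ ((t , (len , feasible) , refl) , _) =
    makespan-≤ js s Gₙ-bound (≤-trans (greedy-nonneg final zero) (Gₙ-bound zero))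
    where
    Gₙ Bₙ : Loads
    Gₙ = loadsAfter idle js s
    Bₙ = loadsAfter idle js t

    start : Dominated idle idle
    start = record
      { greedy-nonneg = λ _ → ≤-refl
      ; other-nonneg  = λ _ → ≤-refl
      ; same-total    = refl
      ; scaled-bound  = λ _ → subst (_≤ (M ℕ.+ k) × maxLoad {suc M} idle) (sym (×-zeroʳ M))
                                  (×-nonneg (M ℕ.+ k) (maxLoad-nonneg {suc M} idle))
      }

    final : Dominated Gₙ Bₙ
    final = greedy-dominated t start greedy js>0 len
      (λ n → subst₂ _≤_ (makespan-loads (take n js) (take n t)) (makespan-loads (take n js) (take n s)) (feasible n))

    Gₙ-bound : ∀ i → Gₙ i ≤ ratio k * makespan js t
    Gₙ-bound i = ×-cancelʳ-≤ k (begin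
      M × Gₙ i                        ≤⟨ scaled-bound final i ⟩
      (M ℕ.+ k) × maxLoad Bₙ          ≡⟨ cong (_×_ (M ℕ.+ k)) (makespan-loads js t) ⟨
      (M ℕ.+ k) × makespan js t       ≡⟨ scaled-ratio k (makespan js t) ⟨
      M × (ratio k * makespan js t)   ∎)
      where open ≤-Reasoning

-- Rounds of equal jobs: in each round the machines f 0, …, f (n-1) receive one
-- job of size x each, in this order.
rounds : ℕ → (Fin n → Fin m) → Schedule m
rounds q f = concat (replicate q (tabulate f))

length-rounds : ∀ q (f : Fin n → Fin m) → length (rounds q f) ≡ q ℕ.* n
length-rounds zero    f = refl
length-rounds (suc q) f = trans (List.length-++ (tabulate f)) (cong₂ ℕ._+_ (List.length-tabulate f) (length-rounds q f))

replicate-+ : ∀ a b (x : ℚ) → replicate (a ℕ.+ b) x ≡ replicate a x ++ replicate b x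
replicate-+ zero    b x = refl
replicate-+ (suc a) b x = cong (x ∷_) (replicate-+ a b x)

round-miss : (f : Fin n → Fin m) (A : Fin m → ℚ) (x : ℚ) {i : Fin m} → (∀ a → i ≢ f a) →
             loadsAfter A (replicate n x) (tabulate f) i ≡ A i
round-miss {zero}  f A x miss = refl
round-miss {suc n} f A x miss =
  trans (round-miss (f ∘ suc) (addLoad A (f zero) x) x (miss ∘ suc)) (addLoad-other A (f zero) x (miss zero))

round-hit : (f : Fin n → Fin m) → Injective _≡_ _≡_ f → (A : Fin m → ℚ) (x : ℚ) (a : Fin n) →
            loadsAfter A (replicate n x) (tabulate f) (f a) ≡ A (f a) + x
round-hit {suc n} f inj A x zero =
  trans (round-miss (f ∘ suc) (addLoad A (f zero) x) x (λ b f0≡fb → Fin.0≢1+n (inj f0≡fb))) (addLoad-same A (f zero) x)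
round-hit {suc n} f inj A x (suc a) =
  trans (round-hit (f ∘ suc) (Fin.suc-injective ∘ inj) (addLoad A (f zero) x) x a)
        (cong (_+ x) (addLoad-other A (f zero) x (λ fa≡f0 → Fin.0≢1+n (sym (inj fa≡f0)))))

rounds-step : ∀ q (f : Fin n → Fin m) (A : Fin m → ℚ) (x : ℚ) →
  loadsAfter A (replicate (suc q ℕ.* n) x) (rounds (suc q) f) ≡
  loadsAfter (loadsAfter A (replicate n x) (tabulate f)) (replicate (q ℕ.* n) x) (rounds q f)
rounds-step {n} q f A x =
  trans (cong (λ js → loadsAfter A js (rounds (suc q) f)) (replicate-+ n (q ℕ.* n) x))
        (loadsAfter-++ A (replicate n x) (tabulate f) (trans (List.length-replicate n) (sym (List.length-tabulate f))))

rounds-miss : ∀ q (f : Fin n → Fin m) (A : Fin m → ℚ) (x : ℚ) {i : Fin m} → (∀ a → i ≢ f a) →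
              loadsAfter A (replicate (q ℕ.* n) x) (rounds q f) i ≡ A i
rounds-miss zero    f A x miss = refl
rounds-miss {n} (suc q) f A x {i} miss =
  trans (cong-app (rounds-step q f A x) i)
        (trans (rounds-miss q f (loadsAfter A (replicate n x) (tabulate f)) x miss) (round-miss f A x miss))

rounds-hit : ∀ q (f : Fin n → Fin m) → Injective _≡_ _≡_ f → (A : Fin m → ℚ) (x : ℚ) (a : Fin n) →
             loadsAfter A (replicate (q ℕ.* n) x) (rounds q f) (f a) ≡ A (f a) + q × x
rounds-hit zero    f inj A x a = sym (+-identityʳ (A (f a)))
rounds-hit {n} (suc q) f inj A x a = begin
  loadsAfter A (replicate (suc q ℕ.* n) x) (rounds (suc q) f) (f a)  ≡⟨ cong-app (rounds-step q f A x) (f a) ⟩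
  loadsAfter A′ (replicate (q ℕ.* n) x) (rounds q f) (f a)           ≡⟨ rounds-hit q f inj A′ x a ⟩
  A′ (f a) + q × x                                                   ≡⟨ cong (_+ q × x) (round-hit f inj A x a) ⟩
  (A (f a) + x) + q × x                                              ≡⟨ +-assoc (A (f a)) x (q × x) ⟩
  A (f a) + suc q × x                                                ∎
  where
  open ≡-Reasoning
  A′ = loadsAfter A (replicate n x) (tabulate f)

greedy-round : (f : Fin n → Fin m) → Injective _≡_ _≡_ f →
  (A : Fin m → ℚ) {x c : ℚ} {js : List ℚ} {s : Schedule m} →
  0ℚ ≤ x → (∀ a → A (f a) ≡ c) → (∀ i → c ≤ A i) →
  GreedyFrom (loadsAfter A (replicate n x) (tabulate f)) js s → GreedyFrom A (replicate n x ++ js) (tabulate f ++ s)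
greedy-round {zero}  f inj A 0≤x visited≡c c≤A rest = rest
greedy-round {suc n} f inj A 0≤x visited≡c c≤A rest =
  (λ i → subst (_≤ A i) (sym (visited≡c zero)) (c≤A i)) ∷
  greedy-round (f ∘ suc) (Fin.suc-injective ∘ inj) (addLoad A (f zero) _) 0≤x
    (λ a → trans (addLoad-other A (f zero) _ (λ fa≡f0 → Fin.0≢1+n (sym (inj fa≡f0)))) (visited≡c (suc a)))
    (λ i → ≤-trans (c≤A i) (addLoad-grows A (f zero) 0≤x i))
    rest

visited? : (f : Fin n → Fin m) (i : Fin m) → (∃ λ a → i ≡ f a) ⊎ (∀ a → i ≢ f a)
visited? f i with Fin.any? (λ a → i Fin.≟ f a)
... | yes visited  = inj₁ visited
... | no  ¬visited = inj₂ (λ a i≡fa → ¬visited (a , i≡fa))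

greedy-rounds : ∀ q (f : Fin n → Fin m) → Injective _≡_ _≡_ f →
  (A : Fin m → ℚ) {x c : ℚ} {js : List ℚ} {s : Schedule m} →
  0ℚ ≤ x → (∀ a → A (f a) ≡ c) → (∀ i → (∀ a → i ≢ f a) → c + q × x ≤ A i) →
  GreedyFrom (loadsAfter A (replicate (q ℕ.* n) x) (rounds q f)) js s →
  GreedyFrom A (replicate (q ℕ.* n) x ++ js) (rounds q f ++ s)
greedy-rounds zero    f inj A 0≤x visited≡c others rest = rest
greedy-rounds {n} (suc q) f inj A {x} {c} {js} {s} 0≤x visited≡c others rest =
  subst₂ (GreedyFrom A) (sym jobs-split) (sym (List.++-assoc (tabulate f) (rounds q f) s))
    (greedy-round f inj A 0≤x visited≡c c≤A
      (greedy-rounds q f inj A′ 0≤x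
        (λ a → trans (round-hit f inj A x a) (cong (_+ x) (visited≡c a)))
        (λ i miss → subst₂ _≤_ (sym (+-assoc c x (q × x))) (sym (round-miss f A x miss)) (others i miss))
        (subst (λ L → GreedyFrom L js s) (rounds-step q f A x) rest)))
  where
  A′ : Fin _ → ℚ
  A′ = loadsAfter A (replicate n x) (tabulate f)

  jobs-split : replicate (suc q ℕ.* n) x ++ js ≡ replicate n x ++ (replicate (q ℕ.* n) x ++ js)
  jobs-split = trans (cong (_++ js) (replicate-+ n (q ℕ.* n) x)) (List.++-assoc (replicate n x) _ js)

  c≤A : ∀ i → c ≤ A i
  c≤A i with visited? f i
  ... | inj₁ (a , refl) = ≤-reflexive (sym (visited≡c a))
  ... | inj₂ miss       = ≤-trans (p≤p+q c (×-nonneg (suc q) 0≤x)) (others i miss)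

module LowerBound (k : ℕ) where

  M : ℕ
  M = suc k

  Machine : Set
  Machine = Fin (suc M)

  u : ℚ
  u = + 1 / suc k

  u-pos : 0ℚ < u
  u-pos = positive⁻¹ u {{normalize-pos 1 (suc k)}}

  one-pos : 0ℚ < 1ℚ
  one-pos = positive⁻¹ 1ℚ

  M×u≡1 : M × u ≡ 1ℚ
  M×u≡1 = unit-fraction-sum k

  k×u≤1 : k × u ≤ 1ℚ
  k×u≤1 = subst (k × u ≤_) M×u≡1
    (subst (_≤ u + k × u) (+-identityˡ (k × u)) (+-monoˡ-≤ (k × u) (<⇒≤ u-pos)))

  greedyRound : Fin M → Machine
  greedyRound = suc

  offlineRound : Fin k → Machine
  offlineRound a = suc (suc a)

  smallJobs : List ℚ
  smallJobs = replicate (k ℕ.* M) u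

  jobs : List ℚ
  jobs = 1ℚ ∷ smallJobs ++ 1ℚ ∷ []

  greedySchedule : Schedule (suc M)
  greedySchedule = zero ∷ rounds k greedyRound ++ suc zero ∷ []

  offlineSchedule : Schedule (suc M)
  offlineSchedule = zero ∷ rounds M offlineRound ++ suc zero ∷ []

  smallJobs-transposed : smallJobs ≡ replicate (M ℕ.* k) u
  smallJobs-transposed = cong (λ n → replicate n u) (ℕ.*-comm k M)

  rest-positive : PositiveJobs (smallJobs ++ 1ℚ ∷ [])
  rest-positive = ++⁺ (replicate⁺ (k ℕ.* M) u-pos) (one-pos ∷ [])

  jobs-positive : PositiveJobs jobs
  jobs-positive = one-pos ∷ rest-positive

  firstBig : Machine → ℚ
  firstBig = addLoad idle zero 1ℚ

  greedyLoads : Machine → ℚ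
  greedyLoads = loadsAfter firstBig smallJobs (rounds k greedyRound)

  greedyLoads-0 : greedyLoads zero ≡ 1ℚ
  greedyLoads-0 = rounds-miss k greedyRound firstBig u (λ _ ())

  greedyLoads-suc : ∀ a → greedyLoads (suc a) ≡ 0ℚ + k × u
  greedyLoads-suc = rounds-hit k greedyRound Fin.suc-injective firstBig u

  greedy-final : loadsAfter idle jobs greedySchedule ≡ addLoad greedyLoads (suc zero) 1ℚ
  greedy-final = loadsAfter-++ firstBig smallJobs (rounds k greedyRound)
    (trans (List.length-replicate (k ℕ.* M)) (sym (length-rounds k greedyRound)))

  -- The schedule is a Greedy run: machine 0 (load 1) never drops below the others
  -- during the rounds, and machine 1 is least loaded for the last job.
  greedy-run : IsGreedy jobs greedySchedule
  greedy-run = (λ _ → ≤-refl) ∷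
    greedy-rounds k greedyRound Fin.suc-injective firstBig (<⇒≤ u-pos) (λ _ → refl) machine-0-ahead
      (last-on-machine-1 ∷ [])
    where
    machine-0-ahead : ∀ i → (∀ a → i ≢ suc a) → 0ℚ + k × u ≤ firstBig i
    machine-0-ahead zero    _    = ≤-trans (≤-reflexive (+-identityˡ (k × u))) k×u≤1
    machine-0-ahead (suc a) miss = contradiction refl (miss a)

    last-on-machine-1 : ∀ i → greedyLoads (suc zero) ≤ greedyLoads i
    last-on-machine-1 zero    = subst₂ _≤_ (sym (greedyLoads-suc zero)) (sym greedyLoads-0) (machine-0-ahead zero (λ _ ()))
    last-on-machine-1 (suc a) = ≤-reflexive (trans (greedyLoads-suc zero) (sym (greedyLoads-suc a)))

  greedy-makespan : ratio k ≤ makespan jobs greedySchedule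
  greedy-makespan = begin
    ratio k                                        ≡⟨ ratio≡ ⟩
    (0ℚ + k × u) + 1ℚ                              ≡⟨ cong (_+ 1ℚ) (greedyLoads-suc zero) ⟨
    greedyLoads (suc zero) + 1ℚ                    ≡⟨ addLoad-same greedyLoads (suc zero) 1ℚ ⟨
    addLoad greedyLoads (suc zero) 1ℚ (suc zero)   ≡⟨ cong-app greedy-final (suc zero) ⟨
    loadsAfter idle jobs greedySchedule (suc zero) ≤⟨ maxLoad-ub (loadsAfter idle jobs greedySchedule) (suc zero) ⟩
    maxLoad (loadsAfter idle jobs greedySchedule)  ≡⟨ makespan-loads jobs greedySchedule ⟨
    makespan jobs greedySchedule                   ∎
    where
    open ≤-Reasoning
    ratio≡ : ratio k ≡ (0ℚ + k × u) + 1ℚ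
    ratio≡ = sym (trans (solve 2 (λ u y → (con 0ℚ :+ y) :+ con 1ℚ := (u :+ y) :+ con 1ℚ :+ :- u) refl u (k × u))
                        (cong (λ z → z + 1ℚ + - u) M×u≡1))

  offlineLoads : Machine → ℚ
  offlineLoads = loadsAfter firstBig (replicate (M ℕ.* k) u) (rounds M offlineRound)

  offlineLoads-1 : offlineLoads (suc zero) ≡ 0ℚ
  offlineLoads-1 = rounds-miss M offlineRound firstBig u (λ _ ())

  offlineLoads-≤1 : ∀ i → offlineLoads i ≤ 1ℚ
  offlineLoads-≤1 zero          = ≤-reflexive (rounds-miss M offlineRound firstBig u (λ _ ()))
  offlineLoads-≤1 (suc zero)    = subst (_≤ 1ℚ) (sym offlineLoads-1) (<⇒≤ one-pos)
  offlineLoads-≤1 (suc (suc a)) = ≤-reflexive (begin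
    offlineLoads (offlineRound a) ≡⟨ rounds-hit M offlineRound (Fin.suc-injective ∘ Fin.suc-injective) firstBig u a ⟩
    0ℚ + M × u                    ≡⟨ +-identityˡ (M × u) ⟩
    M × u                         ≡⟨ M×u≡1 ⟩
    1ℚ                            ∎)
    where open ≡-Reasoning

  offline-final : loadsAfter idle jobs offlineSchedule ≡ addLoad offlineLoads (suc zero) 1ℚ
  offline-final = trans
    (cong (λ small → loadsAfter firstBig (small ++ 1ℚ ∷ []) (rounds M offlineRound ++ suc zero ∷ []))
          smallJobs-transposed)
    (loadsAfter-++ firstBig (replicate (M ℕ.* k) u) (rounds M offlineRound)
      (trans (List.length-replicate (M ℕ.* k)) (sym (length-rounds M offlineRound))))

  offline-loads-≤1 : ∀ i → loadsAfter idle jobs offlineSchedule i ≤ 1ℚ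
  offline-loads-≤1 i = subst (_≤ 1ℚ) (cong-app (sym offline-final) i)
    (addLoad-elim (λ _ v → v ≤ 1ℚ) offlineLoads (suc zero) 1ℚ machine-1 offlineLoads-≤1 i)
    where
    machine-1 : offlineLoads (suc zero) + 1ℚ ≤ 1ℚ
    machine-1 = ≤-reflexive (trans (cong (_+ 1ℚ) offlineLoads-1) (+-identityˡ 1ℚ))

  offline-length : length offlineSchedule ≡ length jobs
  offline-length = cong suc (begin
    length (rounds M offlineRound ++ suc zero ∷ [])  ≡⟨ List.length-++ (rounds M offlineRound) ⟩
    length (rounds M offlineRound) ℕ.+ 1             ≡⟨ cong (ℕ._+ 1) (trans (length-rounds M offlineRound) (ℕ.*-comm M k)) ⟩
    k ℕ.* M ℕ.+ 1                                    ≡⟨ cong (ℕ._+ 1) (List.length-replicate (k ℕ.* M)) ⟨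
    length smallJobs ℕ.+ 1                           ≡⟨ List.length-++ smallJobs ⟨
    length (smallJobs ++ 1ℚ ∷ [])                    ∎)
    where open ≡-Reasoning

  at-least-one : (t : Schedule (suc M)) → length t ≡ length jobs → 1ℚ ≤ makespan jobs t
  at-least-one (j ∷ t) _ = makespan-≥-first j t rest-positive

  offline-makespan-≤1 : makespan jobs offlineSchedule ≤ 1ℚ
  offline-makespan-≤1 = makespan-≤ jobs offlineSchedule offline-loads-≤1 (<⇒≤ one-pos)

  offline-prefix-≤1 : ∀ n → makespan (take n jobs) (take n offlineSchedule) ≤ 1ℚ
  offline-prefix-≤1 n = makespan-≤ (take n jobs) (take n offlineSchedule)
    (λ i → ≤-trans (loadsAfter-prefix idle jobs-positive n offlineSchedule i) (offline-loads-≤1 i)) (<⇒≤ one-pos)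

  -- On every nonempty prefix Greedy already has makespan ≥ 1.
  offline-feasible : FeasibleFor jobs greedySchedule offlineSchedule
  offline-feasible = offline-length , ahead
    where
    ahead : ∀ n → makespan (take n jobs) (take n offlineSchedule) ≤ makespan (take n jobs) (take n greedySchedule)
    ahead zero    = ≤-refl
    ahead (suc n) = ≤-trans (offline-prefix-≤1 (suc n))
      (makespan-≥-first zero (take n (rounds k greedyRound ++ suc zero ∷ [])) (take⁺ n rest-positive))

  opt-value : IsOptA jobs greedySchedule 1ℚ
  opt-value =
    (offlineSchedule , offline-feasible , ≤-antisym offline-makespan-≤1 (at-least-one offlineSchedule offline-length)) ,
    λ t feasible → at-least-one t (proj₁ feasible)

  lower-bound : ∀ c → GreedyBoundedBy (suc M) c → ratio k ≤ c
  lower-bound c bounded = begin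
    ratio k                          ≤⟨ greedy-makespan ⟩
    makespan jobs greedySchedule     ≤⟨ bounded jobs jobs-positive greedySchedule greedy-run 1ℚ opt-value ⟩
    c * 1ℚ                           ≡⟨ *-identityʳ c ⟩
    c                                ∎
    where open ≤-Reasoning

theorem2 : (k : ℕ) →
    GreedyOnlineBoundedRatio (suc (suc k)) ((+ 2 / 1) - (+ 1 / suc k))
theorem2 k = LowerBound.lower-bound k , λ d below → below (ratio k) (UpperBound.upper-bound k)
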